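{- Let $G$ be a gapset with multiplicity $m > 1$, Kunz coordinates $(k_1, k_2, \ldots, k_{m-1})$ and level $\lambda$. Then $\lambda = \min\{k_i : 1 \leq i \leq m-1\}$.
   Context: $\mathbb{N}$ denotes the positive integers and $\mathbb{N}_0 = \mathbb{N} \cup \{0\}$. A gapset is a finite set $G \subset \mathbb{N}$ such that whenever $z \in G$ and $z = x + y$ with $x, y \in \mathbb{N}$, then $x \in G$ or $y \in G$. Its multiplicity is $m = m(G) = \min\{s \in \mathbb{N} : s \notin G\}$. For $i \in [1, m-1]\cap\mathbb{Z}$, let $w_i = \min\{s \in \mathbb{N}_0 \setminus G : s \equiv i \pmod m\}$; the Kunz coordinates of $G$ are $(k_1, \ldots, k_{m-1})$ with $k_i = (w_i - i)/m$. The ratio of $G$ is $r(G) = \min\{x \in \mathbb{N} : x \notin G,\ x \not\equiv 0 \pmod m\}$, and the level of $G$ is $\lambda(G) = \lfloor r(G)/m \rfloor$. -}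

module Defs where

open import Data.Nat using (ℕ; _+_; _∸_; _≤_; _<_; NonZero)
open import Data.Nat.DivMod using (_/_; _%_)
open import Data.List using (List)
open import Data.List.Membership.Propositional using (_∈_; _∉_)
open import Data.List.Relation.Unary.All using (All)
open import Data.Product using (_×_; ∃-syntax)
open import Data.Sum using (_⊎_)
open import Relation.Nullary using (¬_)
open import Relation.Binary.PropositionalEquality using (_≡_)

IsMin : (ℕ → Set) → ℕ → Set
IsMin P x = P x × (∀ y → P y → x ≤ y)

-- A finite set G ⊂ ℕ (positive integers) is represented by a list of its elements.
-- Gapset: all elements positive, and z ∈ G, z = x + y with x,y ≥ 1 ⇒ x ∈ G or y ∈ G.
IsGapset : List ℕ → Set
IsGapset G =
  All (λ z → 1 ≤ z) G ×
  (∀ z x y → z ∈ G → 1 ≤ x → 1 ≤ y → z ≡ x + y → x ∈ G ⊎ y ∈ G)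

IsMultiplicity : List ℕ → ℕ → Set
IsMultiplicity G = IsMin (λ s → 1 ≤ s × s ∉ G)

IsApery : List ℕ → (m : ℕ) → .{{NonZero m}} → ℕ → ℕ → Set
IsApery G m i = IsMin (λ s → s ∉ G × s % m ≡ i % m)

IsKunzCoord : List ℕ → (m : ℕ) → .{{NonZero m}} → ℕ → ℕ → Set
IsKunzCoord G m i k = ∃[ w ] (IsApery G m i w × k ≡ (w ∸ i) / m)

IsRatio : List ℕ → (m : ℕ) → .{{NonZero m}} → ℕ → Set
IsRatio G m = IsMin (λ x → 1 ≤ x × x ∉ G × ¬ (x % m ≡ 0))

{-# OPTIONS --safe #-}
module Submission where

-- Every Apéry element w_i (1 ≤ i ≤ m-1) is a non-gap outside the class of 0 mod m,
-- so r ≤ w_i; conversely r is itself the Apéry element of its own class.  Hence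
-- r = min w_i, and as k_i = ⌊w_i / m⌋ with ⌊_/m⌋ monotone, ⌊r/m⌋ = min k_i.

open import Defs
open import Data.Nat using (ℕ; zero; suc; _+_; _*_; _∸_; _≤_; _<_; NonZero; >-nonZero⁻¹; s≤s; z≤n)
open import Data.Nat.DivMod
  using (_/_; _%_; m≡m%n+[m/n]*n; m*n/n≡m; /-monoˡ-≤; m<n⇒m%n≡m; m%n%n≡m%n; m%n<n)
open import Data.Nat.Properties
  using (≤-antisym; >⇒≢; m+n∸m≡n; n≢0⇒n>0; <⇒≤pred; m≤pred[n]⇒suc[m]≤n)
open import Data.List using (List)
open import Data.List.Membership.Propositional using (_∉_)
open import Data.Product using (_×_; ∃-syntax; _,_; proj₂)
open import Relation.Nullary using (¬_)
open import Relation.Binary.PropositionalEquality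
  using (_≡_; refl; sym; trans; cong; subst; module ≡-Reasoning)
open ≡-Reasoning

IsMin-unique : ∀ {P : ℕ → Set} {x y} → IsMin P x → IsMin P y → x ≡ y
IsMin-unique (Px , x-min) (Py , y-min) = ≤-antisym (x-min _ Py) (y-min _ Px)

module _ (m : ℕ) .{{_ : NonZero m}} where

  [m∸m%n]/n≡m/n : ∀ w → (w ∸ w % m) / m ≡ w / m
  [m∸m%n]/n≡m/n w = begin
    (w ∸ w % m) / m                  ≡⟨ cong (λ v → (v ∸ w % m) / m) (m≡m%n+[m/n]*n w m) ⟩
    (w % m + w / m * m ∸ w % m) / m  ≡⟨ cong (_/ m) (m+n∸m≡n (w % m) (w / m * m)) ⟩
    w / m * m / m                    ≡⟨ m*n/n≡m (w / m) m ⟩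
    w / m                            ∎

  m%n≢0⇒m>0 : ∀ w → ¬ (w % m ≡ 0) → 1 ≤ w
  m%n≢0⇒m>0 zero    0%m≢0 with () ← 0%m≢0 (m<n⇒m%n≡m (>-nonZero⁻¹ m))
  m%n≢0⇒m>0 (suc _) _     = s≤s z≤n

  module _ (G : List ℕ) where

    apery-residue : ∀ {i w} → i < m → IsApery G m i w → w % m ≡ i
    apery-residue i<m ((_ , w≡i) , _) = trans w≡i (m<n⇒m%n≡m i<m)

    kunz≡apery/m : ∀ {i w} → i < m → IsApery G m i w → (w ∸ i) / m ≡ w / m
    kunz≡apery/m {w = w} i<m apery with refl ← apery-residue i<m apery = [m∸m%n]/n≡m/n w

    module _ {r : ℕ} (ratio : IsRatio G m r) where

      ratio≤nongap : ∀ w → w ∉ G → ¬ (w % m ≡ 0) → r ≤ w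
      ratio≤nongap w w∉G w%m≢0 = proj₂ ratio w (m%n≢0⇒m>0 w w%m≢0 , w∉G , w%m≢0)

      ratio≤apery : ∀ {i w} → 1 ≤ i → i < m → IsApery G m i w → r ≤ w
      ratio≤apery {w = w} 1≤i i<m apery@((w∉G , _) , _) with refl ← apery-residue i<m apery =
        ratio≤nongap w w∉G (>⇒≢ 1≤i)

      ratio-isApery : IsApery G m (r % m) r
      ratio-isApery = let (_ , r∉G , r%m≢0) , _ = ratio in
        (r∉G , sym (m%n%n≡m%n r m)) , λ w (w∉G , w≡r) →
          ratio≤nongap w w∉G λ w%m≡0 → r%m≢0 (trans (sym (trans w≡r (m%n%n≡m%n r m))) w%m≡0)

proposition6 : (G : List ℕ) → IsGapset G →
    (m : ℕ) → .{{_ : NonZero m}} → IsMultiplicity G m → 1 < m →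
    (k : ℕ → ℕ) → (∀ i → 1 ≤ i → i ≤ m ∸ 1 → IsKunzCoord G m i (k i)) →
    (r : ℕ) → IsRatio G m r →
    IsMin (λ x → ∃[ i ] (1 ≤ i × i ≤ m ∸ 1 × x ≡ k i)) (r / m)
proposition6 G _ m _ _ k kunz r ratio@((_ , _ , r%m≢0) , _) = attained , minimal
  where
  i = r % m
  1≤i : 1 ≤ i
  1≤i = n≢0⇒n>0 r%m≢0
  i≤m∸1 : i ≤ m ∸ 1
  i≤m∸1 = <⇒≤pred (m%n<n r m)

  attained : ∃[ j ] (1 ≤ j × j ≤ m ∸ 1 × r / m ≡ k j)
  attained with w , apery , kᵢ≡ ← kunz i 1≤i i≤m∸1
    with refl ← IsMin-unique apery (ratio-isApery m G ratio) =
    i , 1≤i , i≤m∸1 , sym (trans kᵢ≡ ([m∸m%n]/n≡m/n m w))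

  minimal : ∀ y → ∃[ j ] (1 ≤ j × j ≤ m ∸ 1 × y ≡ k j) → r / m ≤ y
  minimal y (j , 1≤j , j≤m∸1 , refl) with w , apery , kⱼ≡ ← kunz j 1≤j j≤m∸1 =
    subst (r / m ≤_) (sym (trans kⱼ≡ (kunz≡apery/m m G j<m apery)))
          (/-monoˡ-≤ m (ratio≤apery m G ratio 1≤j j<m apery))
    where
    j<m : j < m
    j<m = m≤pred[n]⇒suc[m]≤n j≤m∸1
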